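{- Let $a=1$, let $b$ be a positive integer and $k\ge1$. The length generating function of culminating walks with steps $+1,-b$ of final height $k$ is $$C_k(t)=\frac{t^k}{D_k}=\frac{t}{h_{k-1}(\mathcal U)},$$ where $D_k=1$ for $1\le k\le b+1$ and $D_k=D_{k-1}-t^{b+1}D_{k-b-1}$ for $k>b+1$, $h_i$ denotes the complete homogeneous symmetric function of degree $i$, and $\mathcal U=(U_1,\dots,U_{b+1})$ are the $b+1$ roots (as Puiseux series in $t$) of the polynomial $u^b-t(1+u^{b+1})$ in $u$.
   Context: A walk of length $n$ with steps $+1,-b$ is a sequence of heights $\eta_0=0,\dots,\eta_n$ with $\eta_{i+1}-\eta_i\in\{1,-b\}$; it is culminating if $\eta_i>0$ for $1\le i\le n$ and $\eta_i<\eta_n$ for $0\le i\le n-1$, and its final height is $\eta_n$. $C_k(t)=\sum t^{\text{length}}$ over culminating walks of final height $k$. -}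

module Defs where

open import Data.Bool using (Bool; true; false; _∧_; if_then_else_)
open import Data.Nat using (ℕ; zero; suc; _∸_; _≤ᵇ_; _≡ᵇ_; _<ᵇ_)
import Data.Nat as ℕ
open import Data.Integer using (ℤ; +_)
import Data.Integer as ℤ
open import Data.List using (List; []; _∷_; _++_; map; length; filter; foldr; upTo)
open import Data.List.Relation.Unary.All using () 
import Data.List as L
open import Data.Vec using (Vec; []; _∷_; zipWith; _∷ʳ_)
import Data.Vec as Vec
open import Data.Fin using (Fin; toℕ)
open import Relation.Nullary.Decidable using (⌊_⌋)
open import Algebra.Bundles using (CommutativeRing)

-- Walks with steps +1 (encoded `true`) and -b (encoded `false`).

step : ℕ → ℤ → Bool → ℤ
step b h true  = h ℤ.+ + 1
step b h false = h ℤ.- + b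

after : ℕ → ℤ → List Bool → List ℤ
after b h []      = []
after b h (s ∷ w) = step b h s ∷ after b (step b h s) w

before : ℕ → ℤ → List Bool → List ℤ
before b h []      = []
before b h (s ∷ w) = h ∷ before b (step b h s) w

final : ℕ → ℤ → List Bool → ℤ
final b h []      = h
final b h (s ∷ w) = final b (step b h s) w

allB : {A : Set} → (A → Bool) → List A → Bool
allB p []       = true
allB p (x ∷ xs) = p x ∧ allB p xs

isCulminating : ℕ → ℕ → List Bool → Bool
isCulminating b k w =
  ⌊ final b (+ 0) w ℤ.≟ + k ⌋
  ∧ allB (λ x → ⌊ + 0 ℤ.<? x ⌋) (after b (+ 0) w)
  ∧ allB (λ x → ⌊ x ℤ.<? final b (+ 0) w ⌋) (before b (+ 0) w)

allWalks : ℕ → List (List Bool)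
allWalks zero    = [] ∷ []
allWalks (suc n) = map (true ∷_) (allWalks n) ++ map (false ∷_) (allWalks n)

Ccoeff : ℕ → ℕ → ℕ → ℕ
Ccoeff b k n = length (filter (λ w → isCulminating b k w Data.Bool.≟ true) (allWalks n))
  where import Data.Bool

-- Formal power series over ℤ as coefficient functions ℕ → ℤ.

conv : (ℕ → ℤ) → (ℕ → ℤ) → ℕ → ℤ
conv f g n = foldr ℤ._+_ (+ 0) (map (λ i → f i ℤ.* g (n ∸ i)) (upTo (suc n)))

tPow : ℕ → ℕ → ℤ
tPow k n = if n ≡ᵇ k then + 1 else + 0

-- D_k: D_k = 1 for 1 ≤ k ≤ b+1, D_k = D_{k-1} - t^{b+1} D_{k-b-1} for k > b+1.
-- Defined with fuel (fuel = k suffices); Dcoeff b k n = coefficient of t^n.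
Dfuel : ℕ → ℕ → ℕ → ℕ → ℤ
Dfuel zero     b k n = tPow 0 n
Dfuel (suc f)  b k n =
  if k ≤ᵇ suc b then tPow 0 n
  else (Dfuel f b (k ∸ 1) n
        ℤ.- (if suc b ≤ᵇ n then Dfuel f b (k ∸ suc b) (n ∸ suc b) else + 0))

Dcoeff : ℕ → ℕ → ℕ → ℤ
Dcoeff b k = Dfuel k b k

module RingDefs {c ℓ} (R : CommutativeRing c ℓ) where
  open CommutativeRing R

  pow : Carrier → ℕ → Carrier
  pow x zero    = 1#
  pow x (suc n) = x * pow x n

  h : ∀ {m} → ℕ → Vec Carrier m → Carrier
  h zero    xs       = 1#
  h (suc i) []       = 0#
  h (suc i) (x ∷ xs) = h (suc i) xs + x * h i (x ∷ xs)

  -- coefficient vector (constant term first) of ∏_j (u - x_j)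
  mulLin : ∀ {n} → Carrier → Vec Carrier (suc n) → Vec Carrier (suc (suc n))
  mulLin x p = zipWith _-_ (0# ∷ p) (Vec.map (x *_) (p ∷ʳ 0#))

  rootPoly : ∀ {m} → Vec Carrier m → Vec Carrier (suc m)
  rootPoly []       = 1# ∷ []
  rootPoly (x ∷ xs) = mulLin x (rootPoly xs)

  targetCoeff : ℕ → Carrier → ℕ → Carrier
  targetCoeff b t i =
    if i ≡ᵇ 0 then - t
    else if i ≡ᵇ b then 1#
    else if i ≡ᵇ suc b then - t
    else 0#

  -- U is the full list (with multiplicity) of the b+1 roots of
  -- u^b - t(1 + u^{b+1}), i.e.  u^b - t(1 + u^{b+1}) = -t · ∏_j (u - U_j)
  -- as polynomials in u (coefficientwise).
  AreRoots : ∀ b → Carrier → Vec Carrier (suc b) → Set ℓ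
  AreRoots b t U = ∀ (i : Fin (suc (suc b))) →
    (- t) * Vec.lookup (rootPoly U) i ≈ targetCoeff b t (toℕ i)

  DRfuel : ℕ → ℕ → Carrier → ℕ → Carrier
  DRfuel zero    b t k = 1#
  DRfuel (suc f) b t k =
    if k ≤ᵇ suc b then 1#
    else DRfuel f b t (k ∸ 1) - pow t (suc b) * DRfuel f b t (k ∸ suc b)

  DR : ℕ → Carrier → ℕ → Carrier
  DR b t k = DRfuel k b t k

-- A culminating walk of final height k starts at 0 and stays in [1, k-1] until its last step
-- reaches k. Writing C_x for the series of such walks started at height x, the first step gives
-- C_k = 1 and C_x = t C_{x+1} + [x > b] t C_{x-b} for x < k; since D_x = D_{x+1} + t^{b+1} D_{x-b},
-- induction on the walk length yields C_x D_k = t^{k-x} D_x for all x ≤ k; x = 0 is the first claim.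
-- For the second, Σ_i (-1)^i e_i h_{n-i} = 0 applied to the roots U reads h_n = t h_{n+1} + t h_{n-b},
-- so t^n h_n(U) has the initial values and the recurrence of D_{n+1}.

module Submission where

open import Defs
open import Algebra.Bundles using (CommutativeRing)
open import Data.Bool using (Bool; true; false; _∧_; if_then_else_)
import Data.Bool as Bool
open import Data.Bool.Properties using (∧-assoc; ∧-zeroʳ)
open import Data.Empty using (⊥-elim)
open import Data.Fin using (Fin; toℕ)
import Data.Fin as Fin
open import Data.Integer using (ℤ; +_; +<+; _⊖_)
import Data.Integer.Properties as ℤₚ
open import Data.List using (List; []; _∷_; _++_; map; length; filter; foldr; applyUpTo)
open import Data.List.Properties using (map-applyUpTo)
open import Data.Nat as ℕ using (ℕ; zero; suc; _∸_; _≤_; _<_; z≤n; s≤s; _≤ᵇ_; _≡ᵇ_; _≤?_)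
open import Data.Nat.Induction using (<-rec)
import Data.Nat.Properties as ℕₚ
open import Data.Product using (_×_; _,_)
open import Data.Sum using (inj₁; inj₂)
open import Data.Vec using (Vec)
open import Function using (_∘_)
open import Relation.Binary.PropositionalEquality
  using (_≡_; _≢_; refl; sym; trans; cong; cong₂; module ≡-Reasoning)
open import Relation.Nullary using (Dec; ¬_; yes; no)
open import Relation.Nullary.Decidable using (⌊_⌋; isYes≗does; dec-true; dec-false)

⌊⌋-true : ∀ {p} {P : Set p} (P? : Dec P) → P → ⌊ P? ⌋ ≡ true
⌊⌋-true P? p = trans (isYes≗does P?) (dec-true P? p)

⌊⌋-false : ∀ {p} {P : Set p} (P? : Dec P) → ¬ P → ⌊ P? ⌋ ≡ false
⌊⌋-false P? ¬p = trans (isYes≗does P?) (dec-false P? ¬p)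

≤ᵇ-false : ∀ {m n} → n < m → (m ≤ᵇ n) ≡ false
≤ᵇ-false {m} {n} n<m = dec-false (m ≤? n) (ℕₚ.<⇒≱ n<m)

≡ᵇ-refl : ∀ n → (n ≡ᵇ n) ≡ true
≡ᵇ-refl n = dec-true (n ℕₚ.≟ n) refl

≡ᵇ-false : ∀ {m n} → m ≢ n → (m ≡ᵇ n) ≡ false
≡ᵇ-false {m} {n} m≢n = dec-false (m ℕₚ.≟ n) m≢n

∧-rearrange : ∀ p a q c → (p ∧ a) ∧ (q ∧ c) ≡ q ∧ p ∧ (a ∧ c)
∧-rearrange p a true  c = ∧-assoc p a c
∧-rearrange p a false c = ∧-zeroʳ (p ∧ a)

count : ∀ {a} {A : Set a} → (A → Bool) → List A → ℕ
count p []       = 0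
count p (x ∷ xs) = if p x then suc (count p xs) else count p xs

module _ {a} {A : Set a} where

  length-filter≡count : ∀ (p : A → Bool) xs → length (filter (λ x → p x Bool.≟ true) xs) ≡ count p xs
  length-filter≡count p []       = refl
  length-filter≡count p (x ∷ xs) with p x
  ... | true  = cong suc (length-filter≡count p xs)
  ... | false = length-filter≡count p xs

  count-cong : ∀ {p q : A → Bool} → (∀ x → p x ≡ q x) → ∀ xs → count p xs ≡ count q xs
  count-cong p≗q []       = refl
  count-cong {p} {q} p≗q (x ∷ xs) rewrite p≗q x with q x
  ... | true  = cong suc (count-cong p≗q xs)
  ... | false = count-cong p≗q xs

  count-++ : ∀ (p : A → Bool) xs ys → count p (xs ++ ys) ≡ count p xs ℕ.+ count p ys
  count-++ p []       ys = refl
  count-++ p (x ∷ xs) ys with p x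
  ... | true  = cong suc (count-++ p xs ys)
  ... | false = count-++ p xs ys

  count-map : ∀ (p : A → Bool) (f : A → A) xs → count p (map f xs) ≡ count (p ∘ f) xs
  count-map p f []       = refl
  count-map p f (x ∷ xs) with p (f x)
  ... | true  = cong suc (count-map p f xs)
  ... | false = count-map p f xs

  count-∧ : ∀ c (p : A → Bool) xs → count (λ x → c ∧ p x) xs ≡ (if c then count p xs else 0)
  count-∧ true  p xs       = refl
  count-∧ false p []       = refl
  count-∧ false p (x ∷ xs) = count-∧ false p xs

module Series where

  open import Data.Integer using (_+_; _*_; _-_)

  conv-applyUpTo : ∀ f g n → conv f g n ≡ foldr _+_ (+ 0) (applyUpTo (λ i → f i * g (n ∸ i)) (suc n))
  conv-applyUpTo f g n = cong (foldr _+_ (+ 0)) (map-applyUpTo (λ i → i) (λ i → f i * g (n ∸ i)) (suc n))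

  conv-suc : ∀ f g n → conv f g (suc n) ≡ f 0 * g (suc n) + conv (f ∘ suc) g n
  conv-suc f g n = trans (conv-applyUpTo f g (suc n))
    (cong (λ z → f 0 * g (suc n) + z) (sym (conv-applyUpTo (f ∘ suc) g n)))

  conv-congˡ : ∀ {f f′} g → (∀ m → f m ≡ f′ m) → ∀ n → conv f g n ≡ conv f′ g n
  conv-congˡ {f} {f′} g f≗f′ zero    = cong (λ z → z * g 0 + + 0) (f≗f′ 0)
  conv-congˡ {f} {f′} g f≗f′ (suc n) = begin
    conv f g (suc n)                           ≡⟨ conv-suc f g n ⟩
    f 0 * g (suc n) + conv (f ∘ suc) g n
      ≡⟨ cong₂ (λ u v → u * g (suc n) + v) (f≗f′ 0) (conv-congˡ g (f≗f′ ∘ suc) n) ⟩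
    f′ 0 * g (suc n) + conv (f′ ∘ suc) g n     ≡⟨ sym (conv-suc f′ g n) ⟩
    conv f′ g (suc n)                          ∎
    where
    open ≡-Reasoning
    open import Algebra.Properties.CommutativeSemigroup ℤₚ.+-commutativeSemigroup using (interchange)

  conv-distribʳ-+ : ∀ f f′ g n → conv (λ m → f m + f′ m) g n ≡ conv f g n + conv f′ g n
  conv-distribʳ-+ f f′ g zero = begin
    (f 0 + f′ 0) * g 0 + + 0        ≡⟨ ℤₚ.+-identityʳ _ ⟩
    (f 0 + f′ 0) * g 0              ≡⟨ ℤₚ.*-distribʳ-+ (g 0) (f 0) (f′ 0) ⟩
    f 0 * g 0 + f′ 0 * g 0          ≡⟨ sym (cong₂ _+_ (ℤₚ.+-identityʳ (f 0 * g 0)) (ℤₚ.+-identityʳ (f′ 0 * g 0))) ⟩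
    conv f g 0 + conv f′ g 0        ∎
    where
    open ≡-Reasoning
    open import Algebra.Properties.CommutativeSemigroup ℤₚ.+-commutativeSemigroup using (interchange)
  conv-distribʳ-+ f f′ g (suc n) = begin
    conv (λ m → f m + f′ m) g (suc n)
      ≡⟨ conv-suc (λ m → f m + f′ m) g n ⟩
    (f 0 + f′ 0) * g (suc n) + conv (λ m → f (suc m) + f′ (suc m)) g n
      ≡⟨ cong₂ _+_ (ℤₚ.*-distribʳ-+ (g (suc n)) (f 0) (f′ 0)) (conv-distribʳ-+ (f ∘ suc) (f′ ∘ suc) g n) ⟩
    (f 0 * g (suc n) + f′ 0 * g (suc n)) + (conv (f ∘ suc) g n + conv (f′ ∘ suc) g n)
      ≡⟨ interchange (f 0 * g (suc n)) (f′ 0 * g (suc n)) (conv (f ∘ suc) g n) (conv (f′ ∘ suc) g n) ⟩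
    (f 0 * g (suc n) + conv (f ∘ suc) g n) + (f′ 0 * g (suc n) + conv (f′ ∘ suc) g n)
      ≡⟨ sym (cong₂ _+_ (conv-suc f g n) (conv-suc f′ g n)) ⟩
    conv f g (suc n) + conv f′ g (suc n)
      ∎
    where
    open ≡-Reasoning
    open import Algebra.Properties.CommutativeSemigroup ℤₚ.+-commutativeSemigroup using (interchange)

  conv-zeroˡ : ∀ g n → conv (λ _ → + 0) g n ≡ + 0
  conv-zeroˡ g zero    = refl
  conv-zeroˡ g (suc n) = trans (conv-suc (λ _ → + 0) g n) (trans (ℤₚ.+-identityˡ _) (conv-zeroˡ g n))

  conv-identityˡ : ∀ g n → conv (tPow 0) g n ≡ g n
  conv-identityˡ g zero    = trans (ℤₚ.+-identityʳ _) (ℤₚ.*-identityˡ _)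
  conv-identityˡ g (suc n) = begin
    conv (tPow 0) g (suc n)               ≡⟨ conv-suc (tPow 0) g n ⟩
    + 1 * g (suc n) + conv (λ _ → + 0) g n ≡⟨ cong₂ _+_ (ℤₚ.*-identityˡ (g (suc n))) (conv-zeroˡ g n) ⟩
    g (suc n) + + 0                       ≡⟨ ℤₚ.+-identityʳ _ ⟩
    g (suc n)                             ∎
    where open ≡-Reasoning

  shift : ℕ → (ℕ → ℤ) → ℕ → ℤ
  shift zero    F n       = F n
  shift (suc d) F zero    = + 0
  shift (suc d) F (suc n) = shift d F n

  shift-cong : ∀ d {F G} → (∀ m → F m ≡ G m) → ∀ n → shift d F n ≡ shift d G n
  shift-cong zero    F≗G n       = F≗G n
  shift-cong (suc d) F≗G zero    = refl
  shift-cong (suc d) F≗G (suc n) = shift-cong d F≗G n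

  shift-distrib-+ : ∀ d F G n → shift d (λ m → F m + G m) n ≡ shift d F n + shift d G n
  shift-distrib-+ zero    F G n       = refl
  shift-distrib-+ (suc d) F G zero    = refl
  shift-distrib-+ (suc d) F G (suc n) = shift-distrib-+ d F G n

  shift-shift : ∀ d e F n → shift d (shift e F) n ≡ shift (d ℕ.+ e) F n
  shift-shift zero    e F n       = refl
  shift-shift (suc d) e F zero    = refl
  shift-shift (suc d) e F (suc n) = shift-shift d e F n

  shift≡if : ∀ d F n → shift d F n ≡ (if d ≤ᵇ n then F (n ∸ d) else + 0)
  shift≡if zero          F n       = refl
  shift≡if (suc d)       F zero    = refl
  shift≡if (suc zero)    F (suc n) = refl
  shift≡if (suc (suc d)) F (suc n) = shift≡if (suc d) F n

  shift-tPow : ∀ d n → shift d (tPow 0) n ≡ tPow d n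
  shift-tPow zero    n       = refl
  shift-tPow (suc d) zero    = refl
  shift-tPow (suc d) (suc n) = shift-tPow d n

module Walks (b k : ℕ) where

  open import Data.Integer using (_<?_; _≟_)

  positive : ℤ → Bool
  positive x = ⌊ + 0 <? x ⌋

  belowTop : ℤ → Bool
  belowTop x = ⌊ x <? + k ⌋

  isClimb : ℤ → List Bool → Bool
  isClimb h []      = ⌊ h ≟ + k ⌋
  isClimb h (s ∷ w) = belowTop h ∧ positive (step b h s) ∧ isClimb (step b h s) w

  isClimb⇒final≡top : ∀ h w → isClimb h w ≡ true → final b h w ≡ + k
  isClimb⇒final≡top h [] climb with h ≟ + k
  ... | yes h≡k = h≡k
  isClimb⇒final≡top h (s ∷ w) climb with belowTop h | positive (step b h s)
  ... | true | true = isClimb⇒final≡top (step b h s) w climb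

  climb-invariants : ∀ h w → final b h w ≡ + k →
    allB positive (after b h w) ∧ allB belowTop (before b h w) ≡ isClimb h w
  climb-invariants h []      final≡k rewrite final≡k = sym (⌊⌋-true (+ k ≟ + k) refl)
  climb-invariants h (s ∷ w) final≡k = trans
    (∧-rearrange (positive (step b h s)) (allB positive (after b (step b h s) w))
                 (belowTop h) (allB belowTop (before b (step b h s) w)))
    (cong (λ z → belowTop h ∧ positive (step b h s) ∧ z) (climb-invariants (step b h s) w final≡k))

  isCulminating≡isClimb : ∀ w → isCulminating b k w ≡ isClimb (+ 0) w
  isCulminating≡isClimb w with final b (+ 0) w ≟ + k
  ... | yes final≡k rewrite final≡k = climb-invariants (+ 0) w final≡k
  ... | no  final≢k with isClimb (+ 0) w in climb
  ...   | true  = ⊥-elim (final≢k (isClimb⇒final≡top (+ 0) w climb))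
  ...   | false = refl

  climbs : ℤ → ℕ → ℕ
  climbs h n = count (isClimb h) (allWalks n)

  Ccoeff≡climbs : ∀ n → Ccoeff b k n ≡ climbs (+ 0) n
  Ccoeff≡climbs n = trans (length-filter≡count (isCulminating b k) (allWalks n))
                          (count-cong isCulminating≡isClimb (allWalks n))

  climbsVia : ℤ → ℤ → ℕ → ℕ
  climbsVia h h′ n = if belowTop h ∧ positive h′ then climbs h′ n else 0

  climbs-suc : ∀ h n {up down} → step b h true ≡ up → step b h false ≡ down →
               climbs h (suc n) ≡ climbsVia h up n ℕ.+ climbsVia h down n
  climbs-suc h n refl refl = trans
    (count-++ (isClimb h) (map (true ∷_) (allWalks n)) (map (false ∷_) (allWalks n)))
    (cong₂ ℕ._+_ (firstStep true) (firstStep false))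
    where
    firstStep : ∀ s → count (isClimb h) (map (s ∷_) (allWalks n)) ≡ climbsVia h (step b h s) n
    firstStep s = trans (count-map (isClimb h) (s ∷_) (allWalks n)) (begin
      count (λ w → belowTop h ∧ positive (step b h s) ∧ isClimb (step b h s) w) (allWalks n)
        ≡⟨ count-∧ (belowTop h) _ (allWalks n) ⟩
      (if belowTop h then count (λ w → positive (step b h s) ∧ isClimb (step b h s) w) (allWalks n) else 0)
        ≡⟨ cong (λ z → if belowTop h then z else 0) (count-∧ (positive (step b h s)) _ (allWalks n)) ⟩
      (if belowTop h then (if positive (step b h s) then climbs (step b h s) n else 0) else 0)
        ≡⟨ if-∧ (belowTop h) ⟩
      climbsVia h (step b h s) n ∎)
      where
      open ≡-Reasoning
      if-∧ : ∀ {x y : ℕ} c {d} → (if c then (if d then x else y) else y) ≡ (if c ∧ d then x else y)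
      if-∧ true  = refl
      if-∧ false = refl

  step-up : ∀ x → step b (+ x) true ≡ + suc x
  step-up x = cong +_ (ℕₚ.+-comm x 1)

  step-down : ∀ x → step b (+ x) false ≡ x ⊖ b
  step-down x = ℤₚ.m-n≡m⊖n x b

  below-top : ∀ {x} → x < k → belowTop (+ x) ≡ true
  below-top x<k = ⌊⌋-true (+ _ <? + k) (+<+ x<k)

  positive-suc : ∀ x → positive (+ suc x) ≡ true
  positive-suc x = ⌊⌋-true (+ 0 <? + suc x) (+<+ (s≤s z≤n))

  nonpositive-⊖ : ∀ {x} → x ≤ b → positive (x ⊖ b) ≡ false
  nonpositive-⊖ {x} x≤b rewrite ℤₚ.⊖-≤ x≤b =
    ⌊⌋-false (+ 0 <? _) (λ 0<x → ℤₚ.<⇒≱ 0<x ℤₚ.neg-≤-pos)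

  climbs-top-zero : climbs (+ k) 0 ≡ 1
  climbs-top-zero rewrite ⌊⌋-true (+ k ≟ + k) refl = refl

  climbs-top-suc : ∀ n → climbs (+ k) (suc n) ≡ 0
  climbs-top-suc n rewrite climbs-suc (+ k) n refl refl | ⌊⌋-false (+ k <? + k) (ℤₚ.<-irrefl refl) = refl

  climbs-zero : ∀ {x} → x ≢ k → climbs (+ x) 0 ≡ 0
  climbs-zero {x} x≢k rewrite ⌊⌋-false (+ x ≟ + k) (x≢k ∘ ℤₚ.+-injective) = refl

  -- From x ≤ b the down-step leaves the positive half-line.
  climbs-low : ∀ {x} n → x < k → x ≤ b → climbs (+ x) (suc n) ≡ climbs (+ suc x) n
  climbs-low {x} n x<k x≤b
    rewrite climbs-suc (+ x) n (step-up x) (step-down x)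
          | below-top x<k | positive-suc x | nonpositive-⊖ x≤b = ℕₚ.+-identityʳ _

  climbs-high : ∀ {x} n → x < k → b < x → climbs (+ x) (suc n) ≡ climbs (+ suc x) n ℕ.+ climbs (+ (x ∸ b)) n
  climbs-high {x} n x<k b<x
    rewrite climbs-suc (+ x) n (step-up x) (trans (step-down x) (ℤₚ.⊖-≥ (ℕₚ.<⇒≤ b<x)))
          | below-top x<k | positive-suc x
          | ⌊⌋-true (+ 0 <? + (x ∸ b)) (+<+ (ℕₚ.m<n⇒0<n∸m b<x)) = refl

module DSeries (b : ℕ) where

  open import Data.Integer using (_+_; _-_)
  open Series

  Dfuel-irrelevant : ∀ f g x n → x ≤ f → x ≤ g → Dfuel f b x n ≡ Dfuel g b x n
  Dfuel-irrelevant zero    zero    x       n _   _   = refl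
  Dfuel-irrelevant zero    (suc g) zero    n _   _   = refl
  Dfuel-irrelevant (suc f) zero    zero    n _   _   = refl
  Dfuel-irrelevant (suc f) (suc g) x       n x≤f x≤g with x ≤ᵇ suc b
  ... | true  = refl
  ... | false = cong₂ _-_ (Dfuel-irrelevant f g (x ∸ 1) n (ℕₚ.∸-monoˡ-≤ 1 x≤f) (ℕₚ.∸-monoˡ-≤ 1 x≤g)) tail
    where
    x∸b∸1≤ : ∀ {f} → x ≤ suc f → x ∸ suc b ≤ f
    x∸b∸1≤ x≤f = ℕₚ.≤-trans (ℕₚ.∸-monoʳ-≤ x (s≤s z≤n)) (ℕₚ.∸-monoˡ-≤ 1 x≤f)
    tail : (if suc b ≤ᵇ n then Dfuel f b (x ∸ suc b) (n ∸ suc b) else + 0)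
         ≡ (if suc b ≤ᵇ n then Dfuel g b (x ∸ suc b) (n ∸ suc b) else + 0)
    tail with suc b ≤ᵇ n
    ... | true  = Dfuel-irrelevant f g (x ∸ suc b) (n ∸ suc b) (x∸b∸1≤ x≤f) (x∸b∸1≤ x≤g)
    ... | false = refl

  Dcoeff-low : ∀ x n → x ≤ suc b → Dcoeff b x n ≡ tPow 0 n
  Dcoeff-low zero    n _     = refl
  Dcoeff-low (suc x) n x≤1+b rewrite dec-true (suc x ≤? suc b) x≤1+b = refl

  Dcoeff-suc : ∀ x n → b < x → Dcoeff b (suc x) n ≡ Dcoeff b x n - shift (suc b) (Dcoeff b (x ∸ b)) n
  Dcoeff-suc x n b<x rewrite ≤ᵇ-false {suc x} {suc b} (s≤s b<x) | shift≡if (suc b) (Dcoeff b (x ∸ b)) n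
    with suc b ≤ᵇ n
  ... | true  = cong (λ z → Dcoeff b x n - z) (Dfuel-irrelevant x (x ∸ b) (x ∸ b) (n ∸ suc b) (ℕₚ.m∸n≤m x b) ℕₚ.≤-refl)
  ... | false = refl

  Dcoeff-pred : ∀ x n → b < x → Dcoeff b x n ≡ Dcoeff b (suc x) n + shift (suc b) (Dcoeff b (x ∸ b)) n
  Dcoeff-pred x n b<x = sym (trans (cong (_+ s) (Dcoeff-suc x n b<x)) (//-rightDividesˡ s (Dcoeff b x n)))
    where
    open import Algebra.Properties.AbelianGroup ℤₚ.+-0-abelianGroup using (//-rightDividesˡ)
    s : ℤ
    s = shift (suc b) (Dcoeff b (x ∸ b)) n

module CulminatingSeries (b k : ℕ) where

  open import Data.Integer using (_+_; _*_)
  open Series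
  open Walks b k
  open DSeries b

  C : ℕ → ℕ → ℤ
  C x n = + climbs (+ x) n

  D : ℕ → ℕ → ℤ
  D = Dcoeff b

  k∸[x∸b]≡ : ∀ {x} → b < x → x < k → k ∸ (x ∸ b) ≡ (k ∸ suc x) ℕ.+ suc b
  k∸[x∸b]≡ {x} b<x x<k = begin
    k ∸ (x ∸ b)                                          ≡⟨ cong (_∸ (x ∸ b)) k≡ ⟩
    ((k ∸ suc x) ℕ.+ suc b) ℕ.+ (x ∸ b) ∸ (x ∸ b)         ≡⟨ ℕₚ.m+n∸n≡m _ (x ∸ b) ⟩
    (k ∸ suc x) ℕ.+ suc b                                ∎
    where
    open ≡-Reasoning
    k≡ : k ≡ ((k ∸ suc x) ℕ.+ suc b) ℕ.+ (x ∸ b)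
    k≡ = begin
      k                                     ≡⟨ ℕₚ.m∸n+n≡m x<k ⟨
      (k ∸ suc x) ℕ.+ suc x                 ≡⟨ cong (λ y → (k ∸ suc x) ℕ.+ suc y) (ℕₚ.m+[n∸m]≡n (ℕₚ.<⇒≤ b<x)) ⟨
      (k ∸ suc x) ℕ.+ (suc b ℕ.+ (x ∸ b))   ≡⟨ ℕₚ.+-assoc (k ∸ suc x) (suc b) (x ∸ b) ⟨
      ((k ∸ suc x) ℕ.+ suc b) ℕ.+ (x ∸ b)   ∎

  climbs*D       : ∀ x → x ≤ k → ∀ n → conv (C x) (D k) n ≡ shift (k ∸ x) (D x) n
  climbs*D-below : ∀ x → x < k → ∀ n → conv (C x) (D k) n ≡ shift (suc (k ∸ suc x)) (D x) n
  climbs*D-step  : ∀ x → x < k → ∀ n → conv (C x ∘ suc) (D k) n ≡ shift (k ∸ suc x) (D x) n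

  climbs*D x x≤k n with ℕₚ.m≤n⇒m<n∨m≡n x≤k
  ... | inj₁ x<k rewrite ℕₚ.+-∸-assoc 1 x<k = climbs*D-below x x<k n
  ... | inj₂ refl rewrite ℕₚ.n∸n≡0 k = trans (conv-congˡ (D k) C≗δ n) (conv-identityˡ (D k) n)
    where
    C≗δ : ∀ m → C k m ≡ tPow 0 m
    C≗δ zero    = cong +_ climbs-top-zero
    C≗δ (suc m) = cong +_ (climbs-top-suc m)

  climbs*D-below x x<k zero    = cong (λ z → z * D k 0 + + 0) (cong +_ (climbs-zero (ℕₚ.<⇒≢ x<k)))
  climbs*D-below x x<k (suc n) = begin
    conv (C x) (D k) (suc n)                     ≡⟨ conv-suc (C x) (D k) n ⟩
    C x 0 * D k (suc n) + conv (C x ∘ suc) (D k) n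
      ≡⟨ cong (λ z → + z * D k (suc n) + conv (C x ∘ suc) (D k) n) (climbs-zero (ℕₚ.<⇒≢ x<k)) ⟩
    + 0 + conv (C x ∘ suc) (D k) n               ≡⟨ ℤₚ.+-identityˡ _ ⟩
    conv (C x ∘ suc) (D k) n                     ≡⟨ climbs*D-step x x<k n ⟩
    shift (k ∸ suc x) (D x) n                    ∎
    where open ≡-Reasoning

  climbs*D-step x x<k n with x ≤? b
  ... | yes x≤b = begin
    conv (C x ∘ suc) (D k) n       ≡⟨ conv-congˡ (D k) (λ m → cong +_ (climbs-low m x<k x≤b)) n ⟩
    conv (C (suc x)) (D k) n       ≡⟨ climbs*D (suc x) x<k n ⟩
    shift (k ∸ suc x) (D (suc x)) n ≡⟨ shift-cong (k ∸ suc x) D[1+x]≗D[x] n ⟩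
    shift (k ∸ suc x) (D x) n      ∎
    where
    open ≡-Reasoning
    D[1+x]≗D[x] : ∀ m → D (suc x) m ≡ D x m
    D[1+x]≗D[x] m = trans (Dcoeff-low (suc x) m (s≤s x≤b)) (sym (Dcoeff-low x m (ℕₚ.m≤n⇒m≤1+n x≤b)))
  ... | no x≰b = begin
    conv (C x ∘ suc) (D k) n
      ≡⟨ conv-congˡ (D k) (λ m → cong +_ (climbs-high m x<k b<x)) n ⟩
    conv (λ m → C (suc x) m + C (x ∸ b) m) (D k) n
      ≡⟨ conv-distribʳ-+ (C (suc x)) (C (x ∸ b)) (D k) n ⟩
    conv (C (suc x)) (D k) n + conv (C (x ∸ b)) (D k) n
      ≡⟨ cong₂ _+_ (climbs*D (suc x) x<k n) (climbs*D (x ∸ b) (ℕₚ.≤-trans (ℕₚ.m∸n≤m x b) (ℕₚ.<⇒≤ x<k)) n) ⟩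
    shift (k ∸ suc x) (D (suc x)) n + shift (k ∸ (x ∸ b)) (D (x ∸ b)) n
      ≡⟨ cong (λ d → shift (k ∸ suc x) (D (suc x)) n + shift d (D (x ∸ b)) n) (k∸[x∸b]≡ b<x x<k) ⟩
    shift (k ∸ suc x) (D (suc x)) n + shift ((k ∸ suc x) ℕ.+ suc b) (D (x ∸ b)) n
      ≡⟨ cong (_+_ (shift (k ∸ suc x) (D (suc x)) n)) (shift-shift (k ∸ suc x) (suc b) (D (x ∸ b)) n) ⟨
    shift (k ∸ suc x) (D (suc x)) n + shift (k ∸ suc x) (shift (suc b) (D (x ∸ b))) n
      ≡⟨ shift-distrib-+ (k ∸ suc x) (D (suc x)) (shift (suc b) (D (x ∸ b))) n ⟨
    shift (k ∸ suc x) (λ m → D (suc x) m + shift (suc b) (D (x ∸ b)) m) n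
      ≡⟨ shift-cong (k ∸ suc x) (λ m → Dcoeff-pred x m b<x) n ⟨
    shift (k ∸ suc x) (D x) n
      ∎
    where
    open ≡-Reasoning
    b<x : b < x
    b<x = ℕₚ.≰⇒> x≰b

  Ccoeff*Dcoeff≡tPow : ∀ n → conv (λ m → + Ccoeff b k m) (Dcoeff b k) n ≡ tPow k n
  Ccoeff*Dcoeff≡tPow n = begin
    conv (λ m → + Ccoeff b k m) (D k) n ≡⟨ conv-congˡ (D k) (cong +_ ∘ Ccoeff≡climbs) n ⟩
    conv (C 0) (D k) n                  ≡⟨ climbs*D 0 z≤n n ⟩
    shift k (tPow 0) n                  ≡⟨ shift-tPow k n ⟩
    tPow k n                            ∎
    where open ≡-Reasoning

module AtRoots {c ℓ} (R : CommutativeRing c ℓ) where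

  open CommutativeRing R renaming (refl to ≈-refl; sym to ≈-sym; trans to ≈-trans)
  open RingDefs R
  open import Algebra.Properties.Ring ring using (-‿distribˡ-*; -‿+-comm; x[y-z]≈xy-xz; [y-z]x≈yx-zx)
  open import Algebra.Properties.CommutativeSemigroup +-commutativeSemigroup using (interchange)
  open import Algebra.Properties.AbelianGroup +-abelianGroup using (//-rightDividesʳ; x∙y⁻¹≈ε⇒x≈y)
  open import Data.Vec using (Vec; []; _∷_; zipWith; _∷ʳ_; lookup)
  import Data.Vec as Vec
  open import Relation.Binary.Reasoning.Setoid setoid

  -- h padded with m leading zeros: hShift xs (m + n) = h n xs, so that the recurrence of h
  -- holds at every index.
  hShift : ∀ {m} → Vec Carrier m → ℕ → Carrier
  hShift []       zero    = 1#
  hShift []       (suc j) = 0#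
  hShift (x ∷ xs) zero    = 0#
  hShift (x ∷ xs) (suc j) = hShift xs j + x * hShift (x ∷ xs) j

  hShift-below : ∀ {m} (xs : Vec Carrier m) j → j < m → hShift xs j ≈ 0#
  hShift-below (x ∷ xs) zero    _         = ≈-refl
  hShift-below (x ∷ xs) (suc j) (s≤s j<m) = begin
    hShift xs j + x * hShift (x ∷ xs) j ≈⟨ +-cong (hShift-below xs j j<m) (*-congˡ (hShift-below (x ∷ xs) j (ℕₚ.m≤n⇒m≤1+n j<m))) ⟩
    0# + x * 0#                         ≈⟨ +-identityˡ _ ⟩
    x * 0#                              ≈⟨ zeroʳ x ⟩
    0#                                  ∎

  hShift-h : ∀ {m} (xs : Vec Carrier m) n → hShift xs (m ℕ.+ n) ≈ h n xs
  hShift-h []       zero    = ≈-refl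
  hShift-h []       (suc n) = ≈-refl
  hShift-h {suc m} (x ∷ xs) zero = begin
    hShift xs (m ℕ.+ 0) + x * hShift (x ∷ xs) (m ℕ.+ 0)
      ≈⟨ +-cong (hShift-h xs 0) (*-congˡ (hShift-below (x ∷ xs) (m ℕ.+ 0) (s≤s (ℕₚ.≤-reflexive (ℕₚ.+-identityʳ m))))) ⟩
    1# + x * 0#  ≈⟨ +-congˡ (zeroʳ x) ⟩
    1# + 0#      ≈⟨ +-identityʳ 1# ⟩
    1#           ∎
  hShift-h {suc m} (x ∷ xs) (suc n) = +-cong (hShift-h xs (suc n))
    (*-congˡ (≈-trans (reflexive (cong (hShift (x ∷ xs)) (ℕₚ.+-suc m n))) (hShift-h (x ∷ xs) n)))

  dot : ∀ {n} → Vec Carrier n → (ℕ → Carrier) → Carrier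
  dot []       f = 0#
  dot (a ∷ as) f = a * f 0 + dot as (f ∘ suc)

  dot-congʳ : ∀ {n} (v : Vec Carrier n) {f g : ℕ → Carrier} → (∀ i → f i ≈ g i) → dot v f ≈ dot v g
  dot-congʳ []       f≈g = ≈-refl
  dot-congʳ (a ∷ as) f≈g = +-cong (*-congˡ (f≈g 0)) (dot-congʳ as (f≈g ∘ suc))

  [a-b]+[c-d]≈[a+c]-[b+d] : ∀ a b c d → (a - b) + (c - d) ≈ (a + c) - (b + d)
  [a-b]+[c-d]≈[a+c]-[b+d] a b c d = ≈-trans (interchange a (- b) c (- d)) (+-congˡ (-‿+-comm b d))

  dot-zipWith-‿ : ∀ {n} (u v : Vec Carrier n) f → dot (zipWith _-_ u v) f ≈ dot u f - dot v f
  dot-zipWith-‿ []       []       f = ≈-sym (-‿inverseʳ 0#)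
  dot-zipWith-‿ (a ∷ u) (b ∷ v) f = begin
    (a - b) * f 0 + dot (zipWith _-_ u v) (f ∘ suc)
      ≈⟨ +-cong ([y-z]x≈yx-zx (f 0) a b) (dot-zipWith-‿ u v (f ∘ suc)) ⟩
    (a * f 0 - b * f 0) + (dot u (f ∘ suc) - dot v (f ∘ suc))
      ≈⟨ [a-b]+[c-d]≈[a+c]-[b+d] _ _ _ _ ⟩
    (a * f 0 + dot u (f ∘ suc)) - (b * f 0 + dot v (f ∘ suc)) ∎

  dot-map-*ˡ : ∀ {n} x (v : Vec Carrier n) f → dot (Vec.map (x *_) v) f ≈ dot v (λ i → x * f i)
  dot-map-*ˡ x []      f = ≈-refl
  dot-map-*ˡ x (a ∷ v) f = +-cong x*a*f≈a*x*f (dot-map-*ˡ x v (f ∘ suc))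
    where
    x*a*f≈a*x*f : x * a * f 0 ≈ a * (x * f 0)
    x*a*f≈a*x*f = ≈-trans (*-congʳ (*-comm x a)) (*-assoc a x (f 0))

  dot-∷ʳ-0# : ∀ {n} (v : Vec Carrier n) f → dot (v ∷ʳ 0#) f ≈ dot v f
  dot-∷ʳ-0# []      f = ≈-trans (+-identityʳ _) (zeroˡ _)
  dot-∷ʳ-0# (a ∷ v) f = +-congˡ (dot-∷ʳ-0# v (f ∘ suc))

  dot-−ʳ : ∀ {n} (v : Vec Carrier n) f g → dot v (λ i → f i - g i) ≈ dot v f - dot v g
  dot-−ʳ []      f g = ≈-sym (-‿inverseʳ 0#)
  dot-−ʳ (a ∷ v) f g = begin
    a * (f 0 - g 0) + dot v (λ i → f (suc i) - g (suc i))
      ≈⟨ +-cong (x[y-z]≈xy-xz a (f 0) (g 0)) (dot-−ʳ v (f ∘ suc) (g ∘ suc)) ⟩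
    (a * f 0 - a * g 0) + (dot v (f ∘ suc) - dot v (g ∘ suc))
      ≈⟨ [a-b]+[c-d]≈[a+c]-[b+d] _ _ _ _ ⟩
    (a * f 0 + dot v (f ∘ suc)) - (a * g 0 + dot v (g ∘ suc)) ∎

  dot-mulLin : ∀ {n} x (p : Vec Carrier (suc n)) f → dot (mulLin x p) f ≈ dot p (λ i → f (suc i) - x * f i)
  dot-mulLin x p f = begin
    dot (mulLin x p) f
      ≈⟨ dot-zipWith-‿ (0# ∷ p) (Vec.map (x *_) (p ∷ʳ 0#)) f ⟩
    (0# * f 0 + dot p (f ∘ suc)) - dot (Vec.map (x *_) (p ∷ʳ 0#)) f
      ≈⟨ +-cong (≈-trans (+-congʳ (zeroˡ (f 0))) (+-identityˡ _))
                (-‿cong (≈-trans (dot-map-*ˡ x (p ∷ʳ 0#) f) (dot-∷ʳ-0# p (λ i → x * f i)))) ⟩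
    dot p (f ∘ suc) - dot p (λ i → x * f i)
      ≈⟨ dot-−ʳ p (f ∘ suc) (λ i → x * f i) ⟨
    dot p (λ i → f (suc i) - x * f i) ∎

  -- The identity Σᵢ (-1)ⁱ eᵢ h_{n-i} = 0 between elementary and complete symmetric polynomials.
  dot-rootPoly-hShift : ∀ {m} (xs : Vec Carrier m) j → dot (rootPoly xs) (λ i → hShift xs (suc j ℕ.+ i)) ≈ 0#
  dot-rootPoly-hShift []       j = ≈-trans (+-identityʳ _) (*-identityˡ _)
  dot-rootPoly-hShift (x ∷ xs) j = begin
    dot (mulLin x (rootPoly xs)) (λ i → hShift (x ∷ xs) (suc j ℕ.+ i))
      ≈⟨ dot-mulLin x (rootPoly xs) _ ⟩
    dot (rootPoly xs) (λ i → hShift (x ∷ xs) (suc j ℕ.+ suc i) - x * hShift (x ∷ xs) (suc j ℕ.+ i))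
      ≈⟨ dot-congʳ (rootPoly xs) telescope ⟩
    dot (rootPoly xs) (λ i → hShift xs (suc j ℕ.+ i))
      ≈⟨ dot-rootPoly-hShift xs j ⟩
    0# ∎
    where
    telescope : ∀ i → hShift (x ∷ xs) (suc j ℕ.+ suc i) - x * hShift (x ∷ xs) (suc j ℕ.+ i) ≈ hShift xs (suc j ℕ.+ i)
    telescope i rewrite ℕₚ.+-suc j i = begin
      (hShift xs (suc j ℕ.+ i) + y) - y  ≈⟨ +-assoc _ y (- y) ⟩
      hShift xs (suc j ℕ.+ i) + (y - y)  ≈⟨ +-congˡ (-‿inverseʳ y) ⟩
      hShift xs (suc j ℕ.+ i) + 0#       ≈⟨ +-identityʳ _ ⟩
      hShift xs (suc j ℕ.+ i)            ∎
      where
      y : Carrier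
      y = x * hShift (x ∷ xs) (suc j ℕ.+ i)

  pow-+ : ∀ x m n → pow x (m ℕ.+ n) ≈ pow x m * pow x n
  pow-+ x zero    n = ≈-sym (*-identityˡ _)
  pow-+ x (suc m) n = ≈-trans (*-congˡ (pow-+ x m n)) (≈-sym (*-assoc _ _ _))

  dotFun : ℕ → (ℕ → Carrier) → (ℕ → Carrier) → Carrier
  dotFun zero    g f = 0#
  dotFun (suc n) g f = g 0 * f 0 + dotFun n (g ∘ suc) (f ∘ suc)

  dot-scaled : ∀ {n} (v : Vec Carrier n) (g : ℕ → Carrier) a f →
               (∀ (i : Fin n) → a * lookup v i ≈ g (toℕ i)) → a * dot v f ≈ dotFun n g f
  dot-scaled []      g a f _   = zeroʳ a
  dot-scaled {suc n} (x ∷ v) g a f a*v≈g = begin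
    a * (x * f 0 + dot v (f ∘ suc))      ≈⟨ distribˡ a _ _ ⟩
    a * (x * f 0) + a * dot v (f ∘ suc)
      ≈⟨ +-cong (≈-trans (≈-sym (*-assoc a x (f 0))) (*-congʳ (a*v≈g Fin.zero)))
                (dot-scaled v (g ∘ suc) a (f ∘ suc) (a*v≈g ∘ Fin.suc)) ⟩
    g 0 * f 0 + dotFun n (g ∘ suc) (f ∘ suc) ∎

  dotFun-last-two : ∀ m (g f : ℕ → Carrier) {a} → (∀ i → i < m → g i ≈ 0#) → g m ≈ 1# → g (suc m) ≈ a →
                    dotFun (suc (suc m)) g f ≈ f m + a * f (suc m)
  dotFun-last-two zero g f g≈0 g0≈1 g1≈a = +-cong
    (≈-trans (*-congʳ g0≈1) (*-identityˡ _)) (≈-trans (+-identityʳ _) (*-congʳ g1≈a))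
  dotFun-last-two (suc m) g f g≈0 gm≈1 gm+1≈a = begin
    g 0 * f 0 + dotFun (suc (suc m)) (g ∘ suc) (f ∘ suc)
      ≈⟨ +-cong (≈-trans (*-congʳ (g≈0 0 (s≤s z≤n))) (zeroˡ _))
                (dotFun-last-two m (g ∘ suc) (f ∘ suc) (λ i i<m → g≈0 (suc i) (s≤s i<m)) gm≈1 gm+1≈a) ⟩
    0# + (f (suc m) + _ * f (suc (suc m))) ≈⟨ +-identityˡ _ ⟩
    f (suc m) + _ * f (suc (suc m))        ∎

  module _ (b : ℕ) (t : Carrier) where

    DRfuel-irrelevant : ∀ f g k → k ≤ f → k ≤ g → DRfuel f b t k ≡ DRfuel g b t k
    DRfuel-irrelevant zero    zero    k    _   _   = refl
    DRfuel-irrelevant zero    (suc g) zero _   _   = refl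
    DRfuel-irrelevant (suc f) zero    zero _   _   = refl
    DRfuel-irrelevant (suc f) (suc g) k    k≤f k≤g with k ≤ᵇ suc b
    ... | true  = refl
    ... | false = cong₂ (λ u v → u - pow t (suc b) * v)
        (DRfuel-irrelevant f g (k ∸ 1) (ℕₚ.∸-monoˡ-≤ 1 k≤f) (ℕₚ.∸-monoˡ-≤ 1 k≤g))
        (DRfuel-irrelevant f g (k ∸ suc b) (k∸b∸1≤ k≤f) (k∸b∸1≤ k≤g))
      where
      k∸b∸1≤ : ∀ {f} → k ≤ suc f → k ∸ suc b ≤ f
      k∸b∸1≤ k≤f = ℕₚ.≤-trans (ℕₚ.∸-monoʳ-≤ k (s≤s z≤n)) (ℕₚ.∸-monoˡ-≤ 1 k≤f)

    DR-low : ∀ n → n ≤ b → DR b t (suc n) ≡ 1#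
    DR-low n n≤b rewrite dec-true (suc n ≤? suc b) (s≤s n≤b) = refl

    DR-high : ∀ r → DR b t (suc (suc (b ℕ.+ r))) ≡ DR b t (suc (b ℕ.+ r)) - pow t (suc b) * DR b t (suc r)
    DR-high r rewrite ≤ᵇ-false {suc (suc (b ℕ.+ r))} {suc b} (s≤s (s≤s (ℕₚ.m≤m+n b r))) =
      cong (λ z → DR b t (suc (b ℕ.+ r)) - pow t (suc b) * z)
        (trans (cong (DRfuel (suc (b ℕ.+ r)) b t) [1+b+r]∸b≡1+r)
               (DRfuel-irrelevant (suc (b ℕ.+ r)) (suc r) (suc r) (s≤s (ℕₚ.m≤n+m r b)) ℕₚ.≤-refl))
      where
      [1+b+r]∸b≡1+r : suc (b ℕ.+ r) ∸ b ≡ suc r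
      [1+b+r]∸b≡1+r = trans (cong (_∸ b) (sym (ℕₚ.+-suc b r))) (ℕₚ.m+n∸m≡n b (suc r))

  module _ (b′ : ℕ) (t : Carrier) (U : Vec Carrier (suc (suc b′))) (roots : AreRoots (suc b′) t U) where

    b : ℕ
    b = suc b′

    targetCoeff-inner : ∀ i → i < b′ → targetCoeff b t (suc i) ≈ 0#
    targetCoeff-inner i i<b′ rewrite ≡ᵇ-false (ℕₚ.<⇒≢ i<b′) | ≡ᵇ-false (ℕₚ.<⇒≢ (ℕₚ.m≤n⇒m≤1+n i<b′)) = ≈-refl

    targetCoeff-b : targetCoeff b t b ≈ 1#
    targetCoeff-b rewrite ≡ᵇ-refl b′ = ≈-refl

    targetCoeff-1+b : targetCoeff b t (suc b) ≈ - t
    targetCoeff-1+b rewrite ≡ᵇ-false (ℕₚ.<⇒≢ (ℕₚ.n<1+n b′) ∘ sym) | ≡ᵇ-refl b′ = ≈-refl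

    -- Evaluating -t · ∏ (u - Uⱼ) = u^b - t(1 + u^{b+1}) against f.
    root-recurrence : ∀ f → dot (rootPoly U) f ≈ 0# → f b ≈ t * f (suc b) + t * f 0
    root-recurrence f dot≈0 = x∙y⁻¹≈ε⇒x≈y (f b) (t * f (suc b) + t * f 0) (begin
      f b - (t * f (suc b) + t * f 0)
        ≈⟨ +-congˡ (-‿+-comm (t * f (suc b)) (t * f 0)) ⟨
      f b + (- (t * f (suc b)) + - (t * f 0))
        ≈⟨ +-assoc (f b) _ _ ⟨
      (f b + - (t * f (suc b))) + - (t * f 0)
        ≈⟨ +-comm _ _ ⟩
      - (t * f 0) + (f b + - (t * f (suc b)))
        ≈⟨ +-cong (-‿distribˡ-* t (f 0)) (+-congˡ (-‿distribˡ-* t (f (suc b)))) ⟩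
      (- t) * f 0 + (f b + (- t) * f (suc b))
        ≈⟨ +-congˡ (dotFun-last-two b′ (targetCoeff b t ∘ suc) (f ∘ suc) targetCoeff-inner targetCoeff-b targetCoeff-1+b) ⟨
      dotFun (suc (suc b)) (targetCoeff b t) f
        ≈⟨ dot-scaled (rootPoly U) (targetCoeff b t) (- t) f roots ⟨
      (- t) * dot (rootPoly U) f
        ≈⟨ *-congˡ dot≈0 ⟩
      (- t) * 0#
        ≈⟨ zeroʳ _ ⟩
      0# ∎)

    hShift-U≈h : ∀ {n j} → suc b ℕ.+ n ≡ j → hShift U j ≈ h n U
    hShift-U≈h {n} refl = hShift-h U n

    h-rec : ∀ n → h n U ≈ t * h (suc n) U + t * hShift U (suc n)
    h-rec n = begin
      h n U
        ≈⟨ hShift-U≈h (cong suc (ℕₚ.+-comm b n)) ⟨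
      hShift U (suc n ℕ.+ b)
        ≈⟨ root-recurrence (λ i → hShift U (suc n ℕ.+ i)) (dot-rootPoly-hShift U n) ⟩
      t * hShift U (suc n ℕ.+ suc b) + t * hShift U (suc n ℕ.+ 0)
        ≈⟨ +-cong (*-congˡ (hShift-U≈h (ℕₚ.+-comm (suc b) (suc n))))
                  (*-congˡ (reflexive (cong (hShift U ∘ suc) (ℕₚ.+-identityʳ n)))) ⟩
      t * h (suc n) U + t * hShift U (suc n) ∎

    G : ℕ → Carrier
    G n = pow t n * h n U

    G-suc : ∀ n → G n ≈ G (suc n) + pow t (suc n) * hShift U (suc n)
    G-suc n = begin
      pow t n * h n U                                          ≈⟨ *-congˡ (h-rec n) ⟩
      pow t n * (t * h (suc n) U + t * hShift U (suc n))       ≈⟨ distribˡ _ _ _ ⟩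
      pow t n * (t * h (suc n) U) + pow t n * (t * hShift U (suc n))
        ≈⟨ +-cong (x[ty]≈[tx]y _ _) (x[ty]≈[tx]y _ _) ⟩
      G (suc n) + pow t (suc n) * hShift U (suc n)             ∎
      where
      x[ty]≈[tx]y : ∀ x y → x * (t * y) ≈ (t * x) * y
      x[ty]≈[tx]y x y = ≈-trans (≈-sym (*-assoc x t y)) (*-congʳ (*-comm x t))

    G-low : ∀ n → n ≤ b → G n ≈ 1#
    G-low zero    _     = *-identityˡ 1#
    G-low (suc n) n<b = begin
      G (suc n)                                    ≈⟨ +-identityʳ _ ⟨
      G (suc n) + 0#                               ≈⟨ +-congˡ tail≈0 ⟨
      G (suc n) + pow t (suc n) * hShift U (suc n) ≈⟨ G-suc n ⟨
      G n                                          ≈⟨ G-low n (ℕₚ.<⇒≤ n<b) ⟩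
      1#                                           ∎
      where
      tail≈0 : pow t (suc n) * hShift U (suc n) ≈ 0#
      tail≈0 = ≈-trans (*-congˡ (hShift-below U (suc n) (s≤s n<b))) (zeroʳ _)

    G-high : ∀ r → G (suc (b ℕ.+ r)) ≈ G (b ℕ.+ r) - pow t (suc b) * G r
    G-high r = begin
      G (suc (b ℕ.+ r))                                   ≈⟨ //-rightDividesʳ (pow t (suc b) * G r) _ ⟨
      (G (suc (b ℕ.+ r)) + pow t (suc b) * G r) - pow t (suc b) * G r
        ≈⟨ +-congʳ (+-congˡ tail) ⟨
      (G (suc (b ℕ.+ r)) + pow t (suc b ℕ.+ r) * hShift U (suc b ℕ.+ r)) - pow t (suc b) * G r
        ≈⟨ +-congʳ (G-suc (b ℕ.+ r)) ⟨
      G (b ℕ.+ r) - pow t (suc b) * G r                   ∎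
      where
      tail : pow t (suc b ℕ.+ r) * hShift U (suc b ℕ.+ r) ≈ pow t (suc b) * G r
      tail = ≈-trans (*-cong (pow-+ t (suc b) r) (hShift-h U r)) (*-assoc _ _ _)

    G≈DR : ∀ n → G n ≈ DR b t (suc n)
    G≈DR = <-rec (λ n → G n ≈ DR b t (suc n)) G≈DR-from-smaller
      where
      G≈DR-from-smaller : ∀ n → (∀ {m} → m < n → G m ≈ DR b t (suc m)) → G n ≈ DR b t (suc n)
      G≈DR-from-smaller n ih with n ≤? b
      ... | yes n≤b = ≈-trans (G-low n n≤b) (reflexive (sym (DR-low b t n n≤b)))
      ... | no  n≰b with ℕₚ.m≤n⇒∃[o]m+o≡n (ℕₚ.≰⇒> n≰b)
      ...   | r , refl = begin
        G (suc (b ℕ.+ r))                                 ≈⟨ G-high r ⟩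
        G (b ℕ.+ r) - pow t (suc b) * G r
          ≈⟨ +-cong (ih (ℕₚ.n<1+n (b ℕ.+ r))) (-‿cong (*-congˡ (ih (s≤s (ℕₚ.m≤n+m r b))))) ⟩
        DR b t (suc (b ℕ.+ r)) - pow t (suc b) * DR b t (suc r) ≈⟨ reflexive (DR-high b t r) ⟨
        DR b t (suc (suc (b ℕ.+ r)))                      ∎

corollary3p4 : ∀ {c ℓ} (b : ℕ) → 1 ≤ b → (k : ℕ) → 1 ≤ k →
    (∀ (n : ℕ) → conv (λ m → + Ccoeff b k m) (Dcoeff b k) n ≡ tPow k n)
    ×
    (∀ (R : CommutativeRing c ℓ) (t : CommutativeRing.Carrier R)
       (U : Vec (CommutativeRing.Carrier R) (suc b)) →
       RingDefs.AreRoots R b t U →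
       CommutativeRing._≈_ R
         (CommutativeRing._*_ R (RingDefs.pow R t (k ∸ 1)) (RingDefs.h R (k ∸ 1) U))
         (RingDefs.DR R b t k))
corollary3p4 (suc b′) (s≤s z≤n) (suc k′) (s≤s z≤n) =
  CulminatingSeries.Ccoeff*Dcoeff≡tPow (suc b′) (suc k′) ,
  λ R t U roots → AtRoots.G≈DR R b′ t U roots k′
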